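{- Let $G^\sigma$ be an oriented hypergraph. Then the following are equivalent: (1) $G^\sigma$ is incidence balanced; (2) each cycle of $G^\sigma$ has positive incidence sign; (3) for any $a,b\in V(G)\cup E(G)$, all paths of $G^\sigma$ from $a$ to $b$ have the same incidence sign; (4) the signed incidence graph $\mathrm{I}G^\sigma$ is balanced; (5) $G^\sigma$ is switching equivalent to $G^+$.
   Context: A hypergraph $G$ has a finite vertex set $V(G)$ and edge set $E(G)$, each edge being a subset of $V(G)$. An incidence is a pair $(e,v)$ with $v\in e\in E(G)$. An oriented hypergraph $G^\sigma$ is $G$ together with a map $\sigma$ from the set of incidences to $\{ -1,1\}$; $G^+$ denotes the oriented hypergraph on $G$ with $\sigma\equiv 1$. $G^\sigma$ is incidence balanced if there is a bipartition $\{X,Y\}$ of $V(G)$ ($X\cup Y=V(G)$, $X\cap Y=\emptyset$, one part possibly empty) such that for every edge $e$, either $\sigma(e,v)=1$ for all $v\in e\cap X$ and $\sigma(e,v)=-1$ for all $v\in e\cap Y$, or $\sigma(e,v)=-1$ for all $v\in e\cap X$ and $\sigma(e,v)=1$ for all $v\in e\cap Y$. A walk is a sequence $a_0,i_1,a_1,\dots,i_t,a_t$ where $a_0,\dots,a_t$ alternate between vertices and edges and $i_j$ is the incidence consisting of $a_{j-1}$ and $a_j$. It is a path if no vertex, edge or incidence is repeated, and a cycle if no vertex, edge or incidence is repeated except $a_0=a_t$. Its incidence sign is $\prod_{j=1}^t\sigma(i_j)$. The signed incidence graph $\mathrm{I}G^\sigma$ is the bipartite graph with vertex set $V(G)\cup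 E(G)$, whose edges are the incidences $(e,v)$ (joining $e$ and $v$), with sign $\sigma(e,v)$; a signed graph is balanced if the product of the edge signs along every cycle is positive. A vertex switching at $v$ replaces $\sigma(e,v)$ by $-\sigma(e,v)$ for all edges $e\ni v$; an edge switching at $e$ replaces $\sigma(e,v)$ by $-\sigma(e,v)$ for all $v\in e$; two oriented hypergraphs on $G$ are switching equivalent if one is obtained from the other by a finite sequence of vertex and/or edge switchings. -}

module Defs where

open import Data.Nat using (ℕ; _≤_)
open import Data.Fin using (Fin; _≟_)
open import Data.Bool using (Bool; true; false; if_then_else_)
open import Data.Sign using (Sign; _*_; opposite) renaming (+ to ⊕; - to ⊖)
open import Data.List using (List; []; _∷_; _++_; [_]; length; foldr)
open import Data.List.Relation.Unary.Unique.Propositional using (Unique)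
open import Data.Sum using (_⊎_; inj₁; inj₂)
open import Data.Product using (_×_; _,_; Σ; ∃; ∃-syntax)
open import Data.Unit using (⊤)
open import Data.Empty using (⊥)
open import Relation.Nullary using (¬_; yes; no)
open import Relation.Binary.PropositionalEquality using (_≡_)

-- A hypergraph with vertex set V(G) = Fin n and edge set E(G) indexed by
-- Fin m; edge e is the subset { v | inc e v ≡ true } of V(G).
record Hypergraph : Set where
  field
    n   : ℕ
    m   : ℕ
    inc : Fin m → Fin n → Bool

open Hypergraph public

-- E(G) is a *set* of subsets: distinct edge indices give distinct subsets.
EdgesDistinct : Hypergraph → Set
EdgesDistinct G = ∀ e f → (∀ v → inc G e v ≡ inc G f v) → e ≡ f

-- An orientation: a sign for each incidence (e , v) with v ∈ e.
-- (Values at non-incidences are irrelevant and never used.)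
Orientation : Hypergraph → Set
Orientation G = Fin (m G) → Fin (n G) → Sign

allPos : (G : Hypergraph) → Orientation G
allPos G e v = ⊕

-- A bipartition {X, Y} of V(G) is given by its indicator X : V → Bool
-- (X v ≡ true means v ∈ X, otherwise v ∈ Y); either part may be empty.
IncidenceBalanced : (G : Hypergraph) → Orientation G → Set
IncidenceBalanced G σ =
  Σ (Fin (n G) → Bool) λ X →
    ∀ e →
      (∀ v → inc G e v ≡ true → σ e v ≡ (if X v then ⊕ else ⊖))
      ⊎ (∀ v → inc G e v ≡ true → σ e v ≡ (if X v then ⊖ else ⊕))

Node : Hypergraph → Set
Node G = Fin (n G) ⊎ Fin (m G)

IncPair : (G : Hypergraph) → Node G → Node G → Set
IncPair G (inj₁ v) (inj₂ e) = inc G e v ≡ true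
IncPair G (inj₂ e) (inj₁ v) = inc G e v ≡ true
IncPair G _        _        = ⊥

-- The incidence determined by two consecutive elements, as the pair (e , v).
-- (For non-incident pairs the value is irrelevant; we store the pair itself.)
Incidence : Hypergraph → Set
Incidence G = Node G × Node G

incidenceOf : (G : Hypergraph) → Node G → Node G → Incidence G
incidenceOf G (inj₂ e) (inj₁ v) = (inj₁ v , inj₂ e)
incidenceOf G a b = (a , b)

incSign : (G : Hypergraph) → Orientation G → Node G → Node G → Sign
incSign G σ (inj₁ v) (inj₂ e) = σ e v
incSign G σ (inj₂ e) (inj₁ v) = σ e v
incSign G σ _        _        = ⊕

-- A walk a₀, i₁, a₁, …, iₜ, aₜ is represented by the list a₀ ∷ … ∷ aₜ
-- (the incidences iⱼ are determined by consecutive elements).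
IsWalk : (G : Hypergraph) → List (Node G) → Set
IsWalk G []           = ⊥
IsWalk G (a ∷ [])     = ⊤
IsWalk G (a ∷ b ∷ ws) = IncPair G a b × IsWalk G (b ∷ ws)

incidences : (G : Hypergraph) → List (Node G) → List (Incidence G)
incidences G []           = []
incidences G (a ∷ [])     = []
incidences G (a ∷ b ∷ ws) = incidenceOf G a b ∷ incidences G (b ∷ ws)

walkSign : (G : Hypergraph) → Orientation G → List (Node G) → Sign
walkSign G σ []           = ⊕
walkSign G σ (a ∷ [])     = ⊕
walkSign G σ (a ∷ b ∷ ws) = incSign G σ a b * walkSign G σ (b ∷ ws)

StartsAt : {A : Set} → A → List A → Set
StartsAt a []       = ⊥
StartsAt a (x ∷ xs) = x ≡ a

EndsAt : {A : Set} → A → List A → Set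
EndsAt a []           = ⊥
EndsAt a (x ∷ [])     = x ≡ a
EndsAt a (x ∷ y ∷ xs) = EndsAt a (y ∷ xs)

IsPath : (G : Hypergraph) → Node G → Node G → List (Node G) → Set
IsPath G a b ws =
  IsWalk G ws × StartsAt a ws × EndsAt b ws
  × Unique ws × Unique (incidences G ws)

-- A cycle a₀, i₁, …, iₜ, aₜ = a₀ is given by cs = a₀ ∷ … ∷ aₜ₋₁; the walk
-- is cs ++ [ a₀ ].  No vertex/edge repeated except a₀ = aₜ, and no
-- incidence repeated.
closeUp : {A : Set} → List A → List A
closeUp []       = []
closeUp (c ∷ cs) = (c ∷ cs) ++ [ c ]

IsCycle : (G : Hypergraph) → List (Node G) → Set
IsCycle G cs =
  IsWalk G (closeUp cs) × Unique cs × Unique (incidences G (closeUp cs))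

-- A simple signed graph: symmetric irreflexive adjacency and edge signs.
record SignedGraph : Set₁ where
  field
    Vtx : Set
    Adj : Vtx → Vtx → Bool
    sgn : Vtx → Vtx → Sign

open SignedGraph public

AdjChain : (Γ : SignedGraph) → List (Vtx Γ) → Set
AdjChain Γ []           = ⊤
AdjChain Γ (a ∷ [])     = ⊤
AdjChain Γ (a ∷ b ∷ xs) = Adj Γ a b ≡ true × AdjChain Γ (b ∷ xs)

chainSign : (Γ : SignedGraph) → List (Vtx Γ) → Sign
chainSign Γ []           = ⊕
chainSign Γ (a ∷ [])     = ⊕
chainSign Γ (a ∷ b ∷ xs) = sgn Γ a b * chainSign Γ (b ∷ xs)

IsGraphCycle : (Γ : SignedGraph) → List (Vtx Γ) → Set
IsGraphCycle Γ cs = 3 ≤ length cs × Unique cs × AdjChain Γ (closeUp cs)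

cycleSign : (Γ : SignedGraph) → List (Vtx Γ) → Sign
cycleSign Γ cs = chainSign Γ (closeUp cs)

Balanced : SignedGraph → Set
Balanced Γ = ∀ cs → IsGraphCycle Γ cs → cycleSign Γ cs ≡ ⊕

incAdj : (G : Hypergraph) → Node G → Node G → Bool
incAdj G (inj₁ v) (inj₂ e) = inc G e v
incAdj G (inj₂ e) (inj₁ v) = inc G e v
incAdj G _        _        = false

incidenceGraph : (G : Hypergraph) → Orientation G → SignedGraph
incidenceGraph G σ = record
  { Vtx = Node G
  ; Adj = incAdj G
  ; sgn = incSign G σ
  }

negIf : Bool → Sign → Sign
negIf true  s = opposite s
negIf false s = s

isYes : {k : ℕ} → Fin k → Fin k → Bool
isYes x y with x ≟ y
... | yes _ = true
... | no  _ = false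

vertexSwitch : (G : Hypergraph) → Fin (n G) → Orientation G → Orientation G
vertexSwitch G v σ e w = negIf (isYes w v) (σ e w)

edgeSwitch : (G : Hypergraph) → Fin (m G) → Orientation G → Orientation G
edgeSwitch G e σ f w = negIf (isYes f e) (σ f w)

applySwitches : (G : Hypergraph) → List (Node G) → Orientation G → Orientation G
applySwitches G []            σ = σ
applySwitches G (inj₁ v ∷ ss) σ = applySwitches G ss (vertexSwitch G v σ)
applySwitches G (inj₂ e ∷ ss) σ = applySwitches G ss (edgeSwitch G e σ)

SwitchingEquivalent : (G : Hypergraph) → Orientation G → Orientation G → Set
SwitchingEquivalent G σ τ =
  Σ (List (Node G)) λ ss →
    ∀ e v → inc G e v ≡ true → applySwitches G ss σ e v ≡ τ e v

-- Everything goes through potentials: maps p : V(G) ∪ E(G) → {±1} with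
-- σ(e,v) = p(v) p(e) on every incidence.  An incidence balancing is such a p
-- (X = {v | p v = +}, and p e records which alternative holds at e), a switching
-- sequence that makes σ positive is one (the parity of the switches at each
-- element), and along a walk the signs telescope to p(start) p(end), which gives
-- (2), (3) and (4).  Conversely, cycles of IG^σ are cycles of G^σ, and two paths
-- from a to b close up into a cycle, so (2) and (3) each imply (4).  Finally (4)
-- yields a potential: a shortest negative closed walk would have no repeated
-- element, hence be a negative cycle; and a finite signed graph without negative
-- closed walks has a potential, by contracting a vertex into a neighbour.

module Submission where

open import Defs
open import Data.Bool using (Bool; true; false; if_then_else_)
open import Data.Bool.Properties using () renaming (_≟_ to _≟ᵇ_)
open import Data.Empty using (⊥-elim)
open import Data.Fin using (Fin; zero; suc) renaming (_≟_ to _≟ᶠ_)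
open import Data.Fin.Properties using (any?; +↔⊎)
open import Data.List using (List; []; _∷_; _++_; [_]; length; map; initLast; _∷ʳ′_)
open import Data.List.Membership.Propositional using (_∈_)
open import Data.List.Membership.Propositional.Properties using (∈-∃++; ∈-++⁺ʳ; ∈-++⁻)
open import Data.List.Properties using (++-assoc; length-++-≤ʳ)
import Data.List.Relation.Unary.All as All
open import Data.List.Relation.Unary.All.Properties using (¬Any⇒All¬)
open import Data.List.Relation.Unary.AllPairs using ([]; _∷_)
open import Data.List.Relation.Unary.Any using (here; there)
open import Data.List.Relation.Unary.Unique.Propositional using (Unique)
open import Data.List.Relation.Unary.Unique.Propositional.Properties using (++⁺)
open import Data.Nat using (ℕ; zero; suc; _<_; z≤n; s≤s)
open import Data.Nat.Properties using (<-≤-trans; m<n⇒m<1+n; n<1+n)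
open import Data.Product using (_×_; _,_; Σ; ∃; ∃₂; proj₁; proj₂)
open import Data.Sign using (Sign; _*_; opposite) renaming (+ to ⊕; - to ⊖)
open import Data.Sign.Properties
  using (*-assoc; *-comm; *-identityʳ; s*s≡+; *-commutativeSemigroup; *-commutativeMonoid) renaming (_≟_ to _≟ˢ_)
open import Algebra.Properties.CommutativeSemigroup *-commutativeSemigroup using (x∙yz≈y∙xz)
open import Algebra.Solver.CommutativeMonoid *-commutativeMonoid using (solve; _⊜_) renaming (_⊕_ to _∙_)
open import Data.Sum using (_⊎_; inj₁; inj₂)
open import Data.Unit using (tt)
open import Function using (_∘_)
open import Function.Bundles using (_↔_; Inverse; _⇔_; mk⇔)
open import Function.Properties.Inverse using (↔⇒↣; ↔-sym)
open import Relation.Binary.Definitions using (DecidableEquality)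
open import Relation.Binary.PropositionalEquality
  using (_≡_; _≢_; refl; sym; trans; cong; cong₂; subst; subst₂; module ≡-Reasoning)
open import Relation.Nullary using (¬_; Dec; yes; no)
open import Relation.Nullary.Decidable using (map′; _⊎-dec_; _×-dec_; via-injection)

s*[s*t]≡t : ∀ s t → s * (s * t) ≡ t
s*[s*t]≡t ⊕ t = refl
s*[s*t]≡t ⊖ ⊕ = refl
s*[s*t]≡t ⊖ ⊖ = refl

[s*t]*s≡t : ∀ s t → s * t * s ≡ t
[s*t]*s≡t s t = trans (*-comm (s * t) s) (s*[s*t]≡t s t)

s*t≡u⇒t≡s*u : ∀ {s t u} → s * t ≡ u → t ≡ s * u
s*t≡u⇒t≡s*u {s} {t} eq = trans (sym (s*[s*t]≡t s t)) (cong (s *_) eq)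

s*t≡+⇒t≡s : ∀ {s t} → s * t ≡ ⊕ → t ≡ s
s*t≡+⇒t≡s {s} eq = trans (s*t≡u⇒t≡s*u {s} eq) (*-identityʳ s)

negIf-* : ∀ b s → negIf b s ≡ negIf b ⊕ * s
negIf-* true  s = refl
negIf-* false s = refl

∃-sign? : {P : Sign → Set} → (∀ s → Dec (P s)) → Dec (∃ P)
∃-sign? P? = map′ (λ { (inj₁ p) → ⊕ , p ; (inj₂ p) → ⊖ , p })
                  (λ { (⊕ , p) → inj₁ p ; (⊖ , p) → inj₂ p })
                  (P? ⊕ ⊎-dec P? ⊖)

SignedRel : Set → Set₁
SignedRel V = V → V → Sign → Set

data SignedWalk {V : Set} (E : SignedRel V) : V → V → Sign → Set where
  []  : ∀ {a} → SignedWalk E a a ⊕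
  _∷_ : ∀ {a b c s t} → E a b s → SignedWalk E b c t → SignedWalk E a c (s * t)

module _ {V : Set} {E : SignedRel V} where

  infixr 5 _++ʷ_

  _++ʷ_ : ∀ {a b c s t} → SignedWalk E a b s → SignedWalk E b c t → SignedWalk E a c (s * t)
  [] ++ʷ w = w
  _++ʷ_ {a} {c = c} (_∷_ {s = s} {t} e w) w′ =
    subst (SignedWalk E a c) (sym (*-assoc s t _)) (e ∷ (w ++ʷ w′))

  edgeʷ : ∀ {a b s} → E a b s → SignedWalk E a b s
  edgeʷ {a} {b} {s} e = subst (SignedWalk E a b) (*-identityʳ s) (e ∷ [])

DecidableRel : {V : Set} → SignedRel V → Set
DecidableRel E = ∀ a b s → Dec (E a b s)

SymmetricRel : {V : Set} → SignedRel V → Set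
SymmetricRel E = ∀ {a b s} → E a b s → E b a s

NoNegativeClosedWalk : {V : Set} → SignedRel V → Set
NoNegativeClosedWalk E = ∀ a → ¬ SignedWalk E a a ⊖

Potential : {V : Set} → SignedRel V → Set
Potential {V} E = Σ (V → Sign) λ p → ∀ {a b s} → E a b s → s ≡ p a * p b

module VertexElimination {N : ℕ} (E : SignedRel (Fin (suc N)))
  (E-sym : SymmetricRel E) (noNeg : NoNegativeClosedWalk E) where

  loop-positive : ∀ {s} → E zero zero s → s ≡ ⊕
  loop-positive {⊕} e = refl
  loop-positive {⊖} e = ⊥-elim (noNeg zero (edgeʷ e))

  Rest : SignedRel (Fin N)
  Rest i k = E (suc i) (suc k)

  liftRest : ∀ {i k s} → SignedWalk Rest i k s → SignedWalk E (suc i) (suc k) s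
  liftRest []      = []
  liftRest (e ∷ w) = e ∷ liftRest w

  extendRest : ¬ (∃₂ λ j t → E zero (suc j) t) → Potential Rest → Potential E
  extendRest isolated (q , q-pot) = p , p-pot
    where
    p : Fin (suc N) → Sign
    p zero    = ⊕
    p (suc i) = q i
    p-pot : ∀ {a b s} → E a b s → s ≡ p a * p b
    p-pot {zero}  {zero}  e = loop-positive e
    p-pot {zero}  {suc k} e = ⊥-elim (isolated (k , _ , e))
    p-pot {suc i} {zero}  e = ⊥-elim (isolated (i , _ , E-sym e))
    p-pot {suc i} {suc k} e = q-pot e

  -- Contract the edge 0 — j of sign t: an edge 0 — k of sign s becomes j — k of
  -- sign t * s.  Walks lift back with the same sign, and a potential q of the
  -- contraction extends by p 0 = t * q j.
  module Contraction (j : Fin N) (t : Sign) (e₀ : E zero (suc j) t) where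

    Contracted : SignedRel (Fin N)
    Contracted i k s = E (suc i) (suc k) s
                     ⊎ (i ≡ j × E zero (suc k) (t * s))
                     ⊎ (k ≡ j × E (suc i) zero (t * s))

    contracted? : DecidableRel E → DecidableRel Contracted
    contracted? E? i k s = E? (suc i) (suc k) s
                         ⊎-dec (i ≟ᶠ j ×-dec E? zero (suc k) (t * s))
                         ⊎-dec (k ≟ᶠ j ×-dec E? (suc i) zero (t * s))

    contracted-sym : SymmetricRel Contracted
    contracted-sym (inj₁ e)                = inj₁ (E-sym e)
    contracted-sym (inj₂ (inj₁ (i≡j , e))) = inj₂ (inj₂ (i≡j , E-sym e))
    contracted-sym (inj₂ (inj₂ (k≡j , e))) = inj₂ (inj₁ (k≡j , E-sym e))

    liftEdge : ∀ {i k s} → Contracted i k s → SignedWalk E (suc i) (suc k) s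
    liftEdge (inj₁ e) = edgeʷ e
    liftEdge {k = k} {s} (inj₂ (inj₁ (refl , e))) =
      subst (SignedWalk E (suc j) (suc k)) (s*[s*t]≡t t s) (E-sym e₀ ∷ edgeʷ e)
    liftEdge {i} {s = s} (inj₂ (inj₂ (refl , e))) =
      subst (SignedWalk E (suc i) (suc j)) ([s*t]*s≡t t s) (e ∷ edgeʷ e₀)

    liftContracted : ∀ {i k s} → SignedWalk Contracted i k s → SignedWalk E (suc i) (suc k) s
    liftContracted []      = []
    liftContracted (e ∷ w) = liftEdge e ++ʷ liftContracted w

    extendContracted : Potential Contracted → Potential E
    extendContracted (q , q-pot) = p , p-pot
      where
      p : Fin (suc N) → Sign
      p zero    = t * q j
      p (suc i) = q i
      from-zero : ∀ {k s} → E zero (suc k) s → s ≡ p zero * q k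
      from-zero {k} {s} e =
        trans (s*t≡u⇒t≡s*u {t} (q-pot contracted-edge)) (sym (*-assoc t (q j) (q k)))
        where
        contracted-edge : Contracted j k (t * s)
        contracted-edge = inj₂ (inj₁ (refl , subst (E zero (suc k)) (sym (s*[s*t]≡t t s)) e))
      p-pot : ∀ {a b s} → E a b s → s ≡ p a * p b
      p-pot {zero}  {zero}  e = trans (loop-positive e) (sym (s*s≡+ (p zero)))
      p-pot {zero}  {suc k} e = from-zero e
      p-pot {suc i} {zero}  e = trans (from-zero (E-sym e)) (*-comm (p zero) (q i))
      p-pot {suc i} {suc k} e = q-pot (inj₁ e)

noNegativeClosedWalk⇒potential-Fin : ∀ N (E : SignedRel (Fin N)) → DecidableRel E → SymmetricRel E →
                                     NoNegativeClosedWalk E → Potential E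
noNegativeClosedWalk⇒potential-Fin zero    E E? E-sym noNeg = (λ ()) , λ { {()} }
noNegativeClosedWalk⇒potential-Fin (suc N) E E? E-sym noNeg
  with any? (λ j → ∃-sign? (E? zero (suc j)))
... | no isolated = extendRest isolated
        (noNegativeClosedWalk⇒potential-Fin N Rest (λ i k → E? (suc i) (suc k)) E-sym
          (λ a w → noNeg (suc a) (liftRest w)))
  where open VertexElimination E E-sym noNeg
... | yes (j , t , e₀) = extendContracted
        (noNegativeClosedWalk⇒potential-Fin N Contracted (contracted? E?) contracted-sym
          (λ a w → noNeg (suc a) (liftContracted w)))
  where open VertexElimination E E-sym noNeg
        open Contraction j t e₀

module _ {N : ℕ} {V : Set} (enum : Fin N ↔ V) where
  open Inverse enum using (to; from; strictlyInverseˡ)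

  finite-≟ : DecidableEquality V
  finite-≟ = via-injection (↔⇒↣ (↔-sym enum)) _≟ᶠ_

  module _ (E : SignedRel V) where

    Pullback : SignedRel (Fin N)
    Pullback i k = E (to i) (to k)

    pushWalk : ∀ {i k s} → SignedWalk Pullback i k s → SignedWalk E (to i) (to k) s
    pushWalk []      = []
    pushWalk (e ∷ w) = e ∷ pushWalk w

    pullback-potential : Potential Pullback → Potential E
    pullback-potential (q , q-pot) = q ∘ from , λ {a} {b} {s} e →
      q-pot (subst₂ (λ x y → E x y s) (sym (strictlyInverseˡ a)) (sym (strictlyInverseˡ b)) e)

    noNegativeClosedWalk⇒potential : DecidableRel E → SymmetricRel E → NoNegativeClosedWalk E → Potential E
    noNegativeClosedWalk⇒potential E? E-sym noNeg = pullback-potential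
      (noNegativeClosedWalk⇒potential-Fin N Pullback (λ i k → E? (to i) (to k)) E-sym
        (λ i w → noNeg (to i) (pushWalk w)))

module _ {A : Set} where

  Repeats : List A → Set
  Repeats xs = ∃₂ λ P x → ∃₂ λ B C → xs ≡ P ++ x ∷ B ++ x ∷ C

  module _ (_≟_ : DecidableEquality A) where
    open import Data.List.Membership.DecPropositional _≟_ using (_∈?_)

    unique⊎repeats : (xs : List A) → Unique xs ⊎ Repeats xs
    unique⊎repeats [] = inj₁ []
    unique⊎repeats (y ∷ ys) with y ∈? ys | unique⊎repeats ys
    ... | yes y∈ys | _ with ∈-∃++ y∈ys
    ...   | B , C , refl = inj₂ ([] , y , B , C , refl)
    unique⊎repeats (y ∷ ys) | no y∉ys | inj₁ uniq = inj₁ (¬Any⇒All¬ ys y∉ys ∷ uniq)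
    unique⊎repeats (y ∷ ys) | no y∉ys | inj₂ (P , x , B , C , refl) = inj₂ (y ∷ P , x , B , C , refl)

  length-<-++∷ : ∀ (B : List A) x C → length B < length (B ++ x ∷ C)
  length-<-++∷ []      x C = s≤s z≤n
  length-<-++∷ (_ ∷ B) x C = s≤s (length-<-++∷ B x C)

  length-loop< : ∀ P (x : A) B C → length (x ∷ B) < length (P ++ x ∷ B ++ x ∷ C)
  length-loop< P x B C = <-≤-trans (s≤s (length-<-++∷ B x C)) (length-++-≤ʳ (x ∷ B ++ x ∷ C) {P})

  length-excise< : ∀ P (x : A) B C → length (P ++ x ∷ C) < length (P ++ x ∷ B ++ x ∷ C)
  length-excise< []      x []      C = n<1+n _
  length-excise< []      x (_ ∷ B) C = m<n⇒m<1+n (length-excise< [] x B C)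
  length-excise< (_ ∷ P) x B       C = s≤s (length-excise< P x B C)

  startsAt-excise : ∀ {c} P (x : A) B C → StartsAt c (P ++ x ∷ B ++ x ∷ C) → StartsAt c (P ++ x ∷ C)
  startsAt-excise []      x B C st = st
  startsAt-excise (_ ∷ P) x B C st = st

  endsAt-∷ʳ : ∀ (a : A) L b → EndsAt b (a ∷ L ++ [ b ])
  endsAt-∷ʳ a []      b = refl
  endsAt-∷ʳ a (c ∷ L) b = endsAt-∷ʳ c L b

  unique-∷ʳ : ∀ (c : A) xs → All.All (c ≢_) xs → Unique xs → Unique (xs ++ [ c ])
  unique-∷ʳ c xs c∉ uniq = ++⁺ uniq (All.[] ∷ []) λ { (c′∈ , here refl) → All.lookup c∉ c′∈ refl }

edges : (Γ : SignedGraph) → SignedRel (Vtx Γ)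
edges Γ a b s = Adj Γ a b ≡ true × sgn Γ a b ≡ s

record IsSimple (Γ : SignedGraph) : Set where
  field
    Adj-irrefl : ∀ a → Adj Γ a a ≢ true
    Adj-sym    : ∀ {a b} → Adj Γ a b ≡ true → Adj Γ b a ≡ true
    sgn-sym    : ∀ {a b} → Adj Γ a b ≡ true → sgn Γ a b ≡ sgn Γ b a

module _ (Γ : SignedGraph) where

  chain-split : ∀ P y Q → AdjChain Γ (P ++ y ∷ Q) → AdjChain Γ (P ++ [ y ]) × AdjChain Γ (y ∷ Q)
  chain-split []           y Q ch         = tt , ch
  chain-split (p ∷ [])     y Q (adj , ch) = (adj , tt) , ch
  chain-split (p ∷ p′ ∷ P) y Q (adj , ch) = let l , r = chain-split (p′ ∷ P) y Q ch in (adj , l) , r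

  chain-join : ∀ P y Q → AdjChain Γ (P ++ [ y ]) → AdjChain Γ (y ∷ Q) → AdjChain Γ (P ++ y ∷ Q)
  chain-join []           y Q _           ch = ch
  chain-join (p ∷ [])     y Q (adj , _)   ch = adj , ch
  chain-join (p ∷ p′ ∷ P) y Q (adj , ch′) ch = adj , chain-join (p′ ∷ P) y Q ch′ ch

  chainSign-++ : ∀ P y Q → chainSign Γ (P ++ y ∷ Q) ≡ chainSign Γ (P ++ [ y ]) * chainSign Γ (y ∷ Q)
  chainSign-++ []           y Q = refl
  chainSign-++ (p ∷ [])     y Q = cong (_* chainSign Γ (y ∷ Q)) (sym (*-identityʳ (sgn Γ p y)))
  chainSign-++ (p ∷ p′ ∷ P) y Q =
    trans (cong (sgn Γ p p′ *_) (chainSign-++ (p′ ∷ P) y Q))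
          (sym (*-assoc (sgn Γ p p′) (chainSign Γ (p′ ∷ P ++ [ y ])) (chainSign Γ (y ∷ Q))))

  chain-excise : ∀ P x B Q → AdjChain Γ (P ++ x ∷ B ++ x ∷ Q) →
                 AdjChain Γ (x ∷ B ++ [ x ]) × AdjChain Γ (P ++ x ∷ Q)
  chain-excise P x B Q ch =
    let pre , rest = chain-split P x (B ++ x ∷ Q) ch
        loop , suf = chain-split (x ∷ B) x Q rest
    in loop , chain-join P x Q pre suf

  chainSign-excise : ∀ P x B Q →
    chainSign Γ (P ++ x ∷ B ++ x ∷ Q) ≡ chainSign Γ (x ∷ B ++ [ x ]) * chainSign Γ (P ++ x ∷ Q)
  chainSign-excise P x B Q = begin
    chainSign Γ (P ++ x ∷ B ++ x ∷ Q)                   ≡⟨ chainSign-++ P x (B ++ x ∷ Q) ⟩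
    chainSign Γ (P ++ [ x ]) * chainSign Γ (x ∷ B ++ x ∷ Q)
      ≡⟨ cong (chainSign Γ (P ++ [ x ]) *_) (chainSign-++ (x ∷ B) x Q) ⟩
    chainSign Γ (P ++ [ x ]) * (chainSign Γ (x ∷ B ++ [ x ]) * chainSign Γ (x ∷ Q))
      ≡⟨ x∙yz≈y∙xz (chainSign Γ (P ++ [ x ])) (chainSign Γ (x ∷ B ++ [ x ])) (chainSign Γ (x ∷ Q)) ⟩
    chainSign Γ (x ∷ B ++ [ x ]) * (chainSign Γ (P ++ [ x ]) * chainSign Γ (x ∷ Q))
      ≡⟨ cong (chainSign Γ (x ∷ B ++ [ x ]) *_) (sym (chainSign-++ P x Q)) ⟩
    chainSign Γ (x ∷ B ++ [ x ]) * chainSign Γ (P ++ x ∷ Q) ∎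
    where open ≡-Reasoning

  module _ (P : Potential (edges Γ)) where
    open Σ P renaming (proj₁ to p; proj₂ to p-pot)

    chainSign-potential : ∀ a L b → AdjChain Γ (a ∷ L) → EndsAt b (a ∷ L) → chainSign Γ (a ∷ L) ≡ p a * p b
    chainSign-potential a []      b _          refl = sym (s*s≡+ (p a))
    chainSign-potential a (c ∷ L) b (adj , ch) end = begin
      sgn Γ a c * chainSign Γ (c ∷ L) ≡⟨ cong₂ _*_ (p-pot (adj , refl)) (chainSign-potential c L b ch end) ⟩
      p a * p c * (p c * p b)         ≡⟨ *-assoc (p a) (p c) _ ⟩
      p a * (p c * (p c * p b))       ≡⟨ cong (p a *_) (s*[s*t]≡t (p c) (p b)) ⟩
      p a * p b                       ∎
      where open ≡-Reasoning

    potential⇒closedChain-positive : ∀ c r → AdjChain Γ (closeUp (c ∷ r)) → chainSign Γ (closeUp (c ∷ r)) ≡ ⊕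
    potential⇒closedChain-positive c r ch =
      trans (chainSign-potential c (r ++ [ c ]) c ch (endsAt-∷ʳ c r c)) (s*s≡+ (p c))

    potential⇒balanced : Balanced Γ
    potential⇒balanced (c ∷ r) (_ , _ , ch) = potential⇒closedChain-positive c r ch

module BalancedClosedWalks (Γ : SignedGraph) (simple : IsSimple Γ) (_≟_ : DecidableEquality (Vtx Γ))
  (balanced : Balanced Γ) where
  open IsSimple simple

  unique-closedChain-positive : ∀ L c → Unique L → StartsAt c L → AdjChain Γ (L ++ [ c ]) →
                                chainSign Γ (L ++ [ c ]) ≡ ⊕
  unique-closedChain-positive (c ∷ []) c _ refl (adj , _) = ⊥-elim (Adj-irrefl c adj)
  unique-closedChain-positive (c ∷ d ∷ []) c _ refl (adj , _) = begin
    sgn Γ c d * (sgn Γ d c * ⊕) ≡⟨ cong (λ s → sgn Γ c d * (s * ⊕)) (sgn-sym (Adj-sym adj)) ⟩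
    sgn Γ c d * (sgn Γ c d * ⊕) ≡⟨ s*[s*t]≡t (sgn Γ c d) ⊕ ⟩
    ⊕                           ∎
    where open ≡-Reasoning
  unique-closedChain-positive cs@(c ∷ _ ∷ _ ∷ _) c uniq refl ch =
    balanced cs (s≤s (s≤s (s≤s z≤n)) , uniq , ch)

  -- A repeated element x splits a closed walk into the closed walk from x back
  -- to x and the shorter closed walk that skips it; their signs multiply.
  closedChain-positive : ∀ k L c → length L < k → StartsAt c L → AdjChain Γ (L ++ [ c ]) →
                         chainSign Γ (L ++ [ c ]) ≡ ⊕
  closedChain-positive (suc k) L c (s≤s len) st ch with unique⊎repeats _≟_ L
  ... | inj₁ uniq = unique-closedChain-positive L c uniq st ch
  ... | inj₂ (P , x , B , C , refl) = begin
    chainSign Γ ((P ++ x ∷ B ++ x ∷ C) ++ [ c ])                    ≡⟨ cong (chainSign Γ) reassoc ⟩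
    chainSign Γ (P ++ x ∷ B ++ x ∷ C ++ [ c ])                      ≡⟨ chainSign-excise Γ P x B (C ++ [ c ]) ⟩
    chainSign Γ (x ∷ B ++ [ x ]) * chainSign Γ (P ++ x ∷ C ++ [ c ]) ≡⟨ cong₂ _*_ loop-positive rest-positive ⟩
    ⊕                                                               ∎
    where
    open ≡-Reasoning
    reassoc : (P ++ x ∷ B ++ x ∷ C) ++ [ c ] ≡ P ++ x ∷ B ++ x ∷ C ++ [ c ]
    reassoc = trans (++-assoc P (x ∷ B ++ x ∷ C) [ c ]) (cong (λ ys → P ++ x ∷ ys) (++-assoc B (x ∷ C) [ c ]))
    excised : AdjChain Γ (x ∷ B ++ [ x ]) × AdjChain Γ (P ++ x ∷ C ++ [ c ])
    excised = chain-excise Γ P x B (C ++ [ c ]) (subst (AdjChain Γ) reassoc ch)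
    loop-positive : chainSign Γ (x ∷ B ++ [ x ]) ≡ ⊕
    loop-positive = closedChain-positive k (x ∷ B) x (<-≤-trans (length-loop< P x B C) len) refl (proj₁ excised)
    rest-positive : chainSign Γ (P ++ x ∷ C ++ [ c ]) ≡ ⊕
    rest-positive = subst (λ L → chainSign Γ L ≡ ⊕) (++-assoc P (x ∷ C) [ c ])
      (closedChain-positive k (P ++ x ∷ C) c (<-≤-trans (length-excise< P x B C) len)
        (startsAt-excise P x B C st) (subst (AdjChain Γ) (sym (++-assoc P (x ∷ C) [ c ])) (proj₂ excised)))

  nonemptyWalk⇒chain : ∀ {a b c s t} → edges Γ a b s → SignedWalk (edges Γ) b c t →
    Σ (List (Vtx Γ)) λ L → AdjChain Γ ((a ∷ L) ++ [ c ]) × chainSign Γ ((a ∷ L) ++ [ c ]) ≡ s * t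
  nonemptyWalk⇒chain (adj , refl) []      = [] , (adj , tt) , refl
  nonemptyWalk⇒chain (adj , refl) (e ∷ w) with nonemptyWalk⇒chain e w
  ... | L , ch , sg = _ ∷ L , (adj , ch) , cong (sgn Γ _ _ *_) sg

  closedWalk-positive : ∀ {a s} → SignedWalk (edges Γ) a a s → s ≡ ⊕
  closedWalk-positive []          = refl
  closedWalk-positive {a} (e ∷ w) with nonemptyWalk⇒chain e w
  ... | L , ch , sg = trans (sym sg) (closedChain-positive _ (a ∷ L) a (n<1+n _) refl ch)

  noNegativeClosedWalk : NoNegativeClosedWalk (edges Γ)
  noNegativeClosedWalk a w with closedWalk-positive w
  ... | ()

balanced⇒potential : ∀ {N} (Γ : SignedGraph) → IsSimple Γ → Fin N ↔ Vtx Γ → Balanced Γ → Potential (edges Γ)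
balanced⇒potential Γ simple enum balanced =
  noNegativeClosedWalk⇒potential enum (edges Γ) edges? edges-sym noNegativeClosedWalk
  where
  open IsSimple simple
  open BalancedClosedWalks Γ simple (finite-≟ enum) balanced
  edges? : DecidableRel (edges Γ)
  edges? a b s = (Adj Γ a b ≟ᵇ true) ×-dec (sgn Γ a b ≟ˢ s)
  edges-sym : SymmetricRel (edges Γ)
  edges-sym (adj , refl) = Adj-sym adj , sym (sgn-sym adj)

parity : {A : Set} → (A → A → Bool) → List A → A → Sign
parity flips []       y = ⊕
parity flips (x ∷ xs) y = negIf (flips x y) (parity flips xs y)

parity-++ : ∀ {A : Set} (flips : A → A → Bool) xs ys y →
            parity flips (xs ++ ys) y ≡ parity flips xs y * parity flips ys y
parity-++ flips []       ys y = refl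
parity-++ flips (x ∷ xs) ys y = begin
  negIf f (parity flips (xs ++ ys) y)               ≡⟨ negIf-* f _ ⟩
  negIf f ⊕ * parity flips (xs ++ ys) y             ≡⟨ cong (negIf f ⊕ *_) (parity-++ flips xs ys y) ⟩
  negIf f ⊕ * (parity flips xs y * parity flips ys y) ≡⟨ sym (*-assoc (negIf f ⊕) _ _) ⟩
  negIf f ⊕ * parity flips xs y * parity flips ys y   ≡⟨ cong (_* parity flips ys y) (sym (negIf-* f _)) ⟩
  negIf f (parity flips xs y) * parity flips ys y     ∎
  where
  open ≡-Reasoning
  f : Bool
  f = flips x y

parity-map : ∀ {A B : Set} {flipsA : A → A → Bool} {flipsB : B → B → Bool} (g : A → B) →
             (∀ x y → flipsB (g x) (g y) ≡ flipsA x y) →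
             ∀ xs y → parity flipsB (map g xs) (g y) ≡ parity flipsA xs y
parity-map g g-flips []       y = refl
parity-map g g-flips (x ∷ xs) y = cong₂ negIf (g-flips x y) (parity-map g g-flips xs y)

parity-map-miss : ∀ {A B : Set} (flips : B → B → Bool) (g : A → B) {z} →
                  (∀ x → flips (g x) z ≡ false) → ∀ xs → parity flips (map g xs) z ≡ ⊕
parity-map-miss flips g misses []       = refl
parity-map-miss flips g misses (x ∷ xs) rewrite misses x = parity-map-miss flips g misses xs

finFlips : ∀ {k} → Fin k → Fin k → Bool
finFlips w j = isYes j w

isYes-suc : ∀ {k} (a b : Fin k) → isYes (Fin.suc a) (suc b) ≡ isYes a b
isYes-suc a b with a ≟ᶠ b
... | yes _ = refl
... | no _  = refl

parity-surjective-Fin : ∀ {k} (f : Fin k → Sign) → ∃ λ L → ∀ j → parity finFlips L j ≡ f j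
parity-surjective-Fin {zero}  f = [] , λ ()
parity-surjective-Fin {suc k} f with parity-surjective-Fin (f ∘ suc) | f zero in f0
... | L , L-ok | ⊕ = map suc L , λ where
  zero    → trans (parity-map-miss finFlips suc (λ _ → refl) L) (sym f0)
  (suc j) → trans (parity-map suc (λ x y → isYes-suc y x) L j) (L-ok j)
... | L , L-ok | ⊖ = zero ∷ map suc L , λ where
  zero    → trans (cong opposite (parity-map-miss finFlips suc (λ _ → refl) L)) (sym f0)
  (suc j) → trans (parity-map suc (λ x y → isYes-suc y x) L j) (L-ok j)

module Incidences (G : Hypergraph) where

  nodeFlips : Node G → Node G → Bool
  nodeFlips (inj₁ w) (inj₁ v) = isYes v w
  nodeFlips (inj₂ f) (inj₂ e) = isYes e f
  nodeFlips _        _        = false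

  applySwitches-parity : ∀ ss τ e v →
    applySwitches G ss τ e v ≡ parity nodeFlips ss (inj₁ v) * parity nodeFlips ss (inj₂ e) * τ e v
  applySwitches-parity []            τ e v = refl
  applySwitches-parity (inj₁ w ∷ ss) τ e v = begin
    applySwitches G ss (vertexSwitch G w τ) e v   ≡⟨ applySwitches-parity ss _ e v ⟩
    S (inj₁ v) * S (inj₂ e) * negIf f (τ e v)     ≡⟨ cong (S (inj₁ v) * S (inj₂ e) *_) (negIf-* f (τ e v)) ⟩
    S (inj₁ v) * S (inj₂ e) * (negIf f ⊕ * τ e v) ≡⟨ solve 4 (λ a b n t → (a ∙ b) ∙ (n ∙ t) ⊜ ((n ∙ a) ∙ b) ∙ t) refl
                                                          (S (inj₁ v)) (S (inj₂ e)) (negIf f ⊕) (τ e v) ⟩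
    negIf f ⊕ * S (inj₁ v) * S (inj₂ e) * τ e v   ≡⟨ cong (λ s → s * S (inj₂ e) * τ e v) (sym (negIf-* f _)) ⟩
    negIf f (S (inj₁ v)) * S (inj₂ e) * τ e v     ∎
    where
    open ≡-Reasoning
    S : Node G → Sign
    S = parity nodeFlips ss
    f : Bool
    f = isYes v w
  applySwitches-parity (inj₂ g ∷ ss) τ e v = begin
    applySwitches G ss (edgeSwitch G g τ) e v     ≡⟨ applySwitches-parity ss _ e v ⟩
    S (inj₁ v) * S (inj₂ e) * negIf f (τ e v)     ≡⟨ cong (S (inj₁ v) * S (inj₂ e) *_) (negIf-* f (τ e v)) ⟩
    S (inj₁ v) * S (inj₂ e) * (negIf f ⊕ * τ e v) ≡⟨ solve 4 (λ a b n t → (a ∙ b) ∙ (n ∙ t) ⊜ (a ∙ (n ∙ b)) ∙ t) refl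
                                                          (S (inj₁ v)) (S (inj₂ e)) (negIf f ⊕) (τ e v) ⟩
    S (inj₁ v) * (negIf f ⊕ * S (inj₂ e)) * τ e v ≡⟨ cong (λ s → S (inj₁ v) * s * τ e v) (sym (negIf-* f _)) ⟩
    S (inj₁ v) * negIf f (S (inj₂ e)) * τ e v     ∎
    where
    open ≡-Reasoning
    S : Node G → Sign
    S = parity nodeFlips ss
    f : Bool
    f = isYes e g

  parity-vertex : ∀ Lv Le v → parity nodeFlips (map inj₁ Lv ++ map inj₂ Le) (inj₁ v) ≡ parity finFlips Lv v
  parity-vertex Lv Le v = begin
    parity nodeFlips (map inj₁ Lv ++ map inj₂ Le) (inj₁ v)
      ≡⟨ parity-++ nodeFlips (map inj₁ Lv) (map inj₂ Le) (inj₁ v) ⟩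
    parity nodeFlips (map inj₁ Lv) (inj₁ v) * parity nodeFlips (map inj₂ Le) (inj₁ v)
      ≡⟨ cong₂ _*_ (parity-map inj₁ (λ _ _ → refl) Lv v) (parity-map-miss nodeFlips inj₂ (λ _ → refl) Le) ⟩
    parity finFlips Lv v * ⊕
      ≡⟨ *-identityʳ _ ⟩
    parity finFlips Lv v ∎
    where open ≡-Reasoning

  parity-edge : ∀ Lv Le e → parity nodeFlips (map inj₁ Lv ++ map inj₂ Le) (inj₂ e) ≡ parity finFlips Le e
  parity-edge Lv Le e = begin
    parity nodeFlips (map inj₁ Lv ++ map inj₂ Le) (inj₂ e)
      ≡⟨ parity-++ nodeFlips (map inj₁ Lv) (map inj₂ Le) (inj₂ e) ⟩
    parity nodeFlips (map inj₁ Lv) (inj₂ e) * parity nodeFlips (map inj₂ Le) (inj₂ e)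
      ≡⟨ cong₂ _*_ (parity-map-miss nodeFlips inj₁ (λ _ → refl) Lv) (parity-map inj₂ (λ _ _ → refl) Le e) ⟩
    parity finFlips Le e ∎
    where open ≡-Reasoning

  parity-surjective-Node : (f : Node G → Sign) → ∃ λ ss → ∀ y → parity nodeFlips ss y ≡ f y
  parity-surjective-Node f with parity-surjective-Fin (f ∘ inj₁) | parity-surjective-Fin (f ∘ inj₂)
  ... | Lv , Lv-ok | Le , Le-ok = map inj₁ Lv ++ map inj₂ Le , λ where
    (inj₁ v) → trans (parity-vertex Lv Le v) (Lv-ok v)
    (inj₂ e) → trans (parity-edge Lv Le e) (Le-ok e)

  _∈ᵢ_ : Node G → Incidence G → Set
  y ∈ᵢ (a , b) = y ≡ a ⊎ y ≡ b

  ∈ᵢ-incidenceOfˡ : ∀ a b → a ∈ᵢ incidenceOf G a b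
  ∈ᵢ-incidenceOfˡ (inj₁ _) _        = inj₁ refl
  ∈ᵢ-incidenceOfˡ (inj₂ _) (inj₁ _) = inj₂ refl
  ∈ᵢ-incidenceOfˡ (inj₂ _) (inj₂ _) = inj₁ refl

  ∈ᵢ-incidenceOfʳ : ∀ a b → b ∈ᵢ incidenceOf G a b
  ∈ᵢ-incidenceOfʳ (inj₁ _) _        = inj₂ refl
  ∈ᵢ-incidenceOfʳ (inj₂ _) (inj₁ _) = inj₁ refl
  ∈ᵢ-incidenceOfʳ (inj₂ _) (inj₂ _) = inj₂ refl

  ∈ᵢ-incidenceOf⁻ : ∀ a b {y} → y ∈ᵢ incidenceOf G a b → y ≡ a ⊎ y ≡ b
  ∈ᵢ-incidenceOf⁻ (inj₁ _) _        y∈         = y∈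
  ∈ᵢ-incidenceOf⁻ (inj₂ _) (inj₁ _) (inj₁ y≡b) = inj₂ y≡b
  ∈ᵢ-incidenceOf⁻ (inj₂ _) (inj₁ _) (inj₂ y≡a) = inj₁ y≡a
  ∈ᵢ-incidenceOf⁻ (inj₂ _) (inj₂ _) y∈         = y∈

  ∈ᵢ-incidences : ∀ ws {z y} → z ∈ incidences G ws → y ∈ᵢ z → y ∈ ws
  ∈ᵢ-incidences (a ∷ b ∷ ws) (here refl) y∈ with ∈ᵢ-incidenceOf⁻ a b y∈
  ... | inj₁ refl = here refl
  ... | inj₂ refl = there (here refl)
  ∈ᵢ-incidences (a ∷ b ∷ ws) (there z∈) y∈ = there (∈ᵢ-incidences (b ∷ ws) z∈ y∈)

  unique⇒uniqueIncidences : ∀ ws → Unique ws → Unique (incidences G ws)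
  unique⇒uniqueIncidences []           _           = []
  unique⇒uniqueIncidences (a ∷ [])     _           = []
  unique⇒uniqueIncidences (a ∷ b ∷ ws) (a∉ ∷ uniq) =
    All.tabulate (λ z∈ eq → All.lookup a∉ (∈ᵢ-incidences (b ∷ ws) z∈ (subst (a ∈ᵢ_) eq (∈ᵢ-incidenceOfˡ a b))) refl)
    ∷ unique⇒uniqueIncidences (b ∷ ws) uniq

  cycle-uniqueIncidences : ∀ c d e r → Unique (c ∷ d ∷ e ∷ r) → Unique (incidences G (closeUp (c ∷ d ∷ e ∷ r)))
  cycle-uniqueIncidences c d e r (c∉ ∷ uniq@(d∉ ∷ _)) =
    (first≢second All.∷ All.tabulate first≢later)
    ∷ unique⇒uniqueIncidences (d ∷ e ∷ r ++ [ c ]) (unique-∷ʳ c (d ∷ e ∷ r) c∉ uniq)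
    where
    first≢second : incidenceOf G c d ≢ incidenceOf G d e
    first≢second eq with ∈ᵢ-incidenceOf⁻ d e (subst (c ∈ᵢ_) eq (∈ᵢ-incidenceOfˡ c d))
    ... | inj₁ c≡d = All.lookup c∉ (here refl) c≡d
    ... | inj₂ c≡e = All.lookup c∉ (there (here refl)) c≡e
    first≢later : ∀ {z} → z ∈ incidences G (e ∷ r ++ [ c ]) → incidenceOf G c d ≢ z
    first≢later z∈ eq with ∈-++⁻ (e ∷ r) (∈ᵢ-incidences (e ∷ r ++ [ c ]) z∈ (subst (d ∈ᵢ_) eq (∈ᵢ-incidenceOfʳ c d)))
    ... | inj₁ d∈         = All.lookup d∉ d∈ refl
    ... | inj₂ (here d≡c) = All.lookup c∉ (here refl) (sym d≡c)

module Oriented (G : Hypergraph) (σ : Orientation G) where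
  open Incidences G

  IG : SignedGraph
  IG = incidenceGraph G σ

  adj⇒incPair : ∀ a b → incAdj G a b ≡ true → IncPair G a b
  adj⇒incPair (inj₁ _) (inj₂ _) adj = adj
  adj⇒incPair (inj₂ _) (inj₁ _) adj = adj

  incPair⇒adj : ∀ a b → IncPair G a b → incAdj G a b ≡ true
  incPair⇒adj (inj₁ _) (inj₂ _) i = i
  incPair⇒adj (inj₂ _) (inj₁ _) i = i

  incPair-sym : ∀ a b → IncPair G a b → IncPair G b a
  incPair-sym (inj₁ _) (inj₂ _) i = i
  incPair-sym (inj₂ _) (inj₁ _) i = i

  incSign-sym : ∀ a b → incSign G σ a b ≡ incSign G σ b a
  incSign-sym (inj₁ _) (inj₁ _) = refl
  incSign-sym (inj₁ _) (inj₂ _) = refl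
  incSign-sym (inj₂ _) (inj₁ _) = refl
  incSign-sym (inj₂ _) (inj₂ _) = refl

  incidenceGraph-simple : IsSimple IG
  incidenceGraph-simple = record
    { Adj-irrefl = λ { (inj₁ _) () ; (inj₂ _) () }
    ; Adj-sym    = λ {a} {b} adj → incPair⇒adj b a (incPair-sym a b (adj⇒incPair a b adj))
    ; sgn-sym    = λ {a} {b} _ → incSign-sym a b
    }

  walk⇒chain : ∀ ws → IsWalk G ws → AdjChain IG ws
  walk⇒chain (a ∷ [])     _       = tt
  walk⇒chain (a ∷ b ∷ ws) (i , w) = incPair⇒adj a b i , walk⇒chain (b ∷ ws) w

  chain⇒walk : ∀ a ws → AdjChain IG (a ∷ ws) → IsWalk G (a ∷ ws)
  chain⇒walk a []       _          = tt
  chain⇒walk a (b ∷ ws) (adj , ch) = adj⇒incPair a b adj , chain⇒walk b ws ch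

  walkSign≡chainSign : ∀ ws → walkSign G σ ws ≡ chainSign IG ws
  walkSign≡chainSign []           = refl
  walkSign≡chainSign (a ∷ [])     = refl
  walkSign≡chainSign (a ∷ b ∷ ws) = cong (incSign G σ a b *_) (walkSign≡chainSign (b ∷ ws))

  incidences⇒potential : (p : Node G → Sign) →
    (∀ {e v} → inc G e v ≡ true → σ e v ≡ p (inj₁ v) * p (inj₂ e)) → Potential (edges IG)
  incidences⇒potential p p-inc = p , p-pot
    where
    p-pot : ∀ {a b s} → edges IG a b s → s ≡ p a * p b
    p-pot {inj₁ v} {inj₂ e} (i , refl) = p-inc i
    p-pot {inj₂ e} {inj₁ v} (i , refl) = trans (p-inc i) (*-comm (p (inj₁ v)) (p (inj₂ e)))

  incidenceBalanced⇒potential : IncidenceBalanced G σ → Potential (edges IG)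
  incidenceBalanced⇒potential (X , side) = incidences⇒potential p p-inc
    where
    p : Node G → Sign
    p (inj₁ v) = if X v then ⊕ else ⊖
    p (inj₂ e) with side e
    ... | inj₁ _ = ⊕
    ... | inj₂ _ = ⊖
    if-flip : ∀ b → (if b then ⊖ else ⊕) ≡ (if b then ⊕ else ⊖) * ⊖
    if-flip true  = refl
    if-flip false = refl
    p-inc : ∀ {e v} → inc G e v ≡ true → σ e v ≡ p (inj₁ v) * p (inj₂ e)
    p-inc {e} {v} i with side e
    ... | inj₁ same    = trans (same v i) (sym (*-identityʳ _))
    ... | inj₂ flipped = trans (flipped v i) (if-flip (X v))

  potential⇒incidenceBalanced : Potential (edges IG) → IncidenceBalanced G σ
  potential⇒incidenceBalanced (p , p-pot) = X , side
    where
    positive : Sign → Bool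
    positive ⊕ = true
    positive ⊖ = false
    X : Fin (n G) → Bool
    X v = positive (p (inj₁ v))
    same : ∀ s → s * ⊕ ≡ (if positive s then ⊕ else ⊖)
    same ⊕ = refl
    same ⊖ = refl
    flipped : ∀ s → s * ⊖ ≡ (if positive s then ⊖ else ⊕)
    flipped ⊕ = refl
    flipped ⊖ = refl
    side : ∀ e → (∀ v → inc G e v ≡ true → σ e v ≡ (if X v then ⊕ else ⊖))
               ⊎ (∀ v → inc G e v ≡ true → σ e v ≡ (if X v then ⊖ else ⊕))
    side e with p (inj₂ e) in pe
    ... | ⊕ = inj₁ λ v i → trans (p-pot (i , refl)) (trans (cong (p (inj₁ v) *_) pe) (same (p (inj₁ v))))
    ... | ⊖ = inj₂ λ v i → trans (p-pot (i , refl)) (trans (cong (p (inj₁ v) *_) pe) (flipped (p (inj₁ v))))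

  module _ (P : Potential (edges IG)) where
    open Σ P renaming (proj₁ to p; proj₂ to p-pot)

    walkSign-potential : ∀ a ws b → IsWalk G (a ∷ ws) → EndsAt b (a ∷ ws) → walkSign G σ (a ∷ ws) ≡ p a * p b
    walkSign-potential a ws b w end =
      trans (walkSign≡chainSign (a ∷ ws)) (chainSign-potential IG P a ws b (walk⇒chain (a ∷ ws) w) end)

    potential⇒positiveCycles : ∀ cs → IsCycle G cs → walkSign G σ (closeUp cs) ≡ ⊕
    potential⇒positiveCycles (c ∷ r) (w , _) =
      trans (walkSign≡chainSign (closeUp (c ∷ r))) (potential⇒closedChain-positive IG P c r (walk⇒chain _ w))

    potential⇒pathSignsAgree : ∀ a b ps qs → IsPath G a b ps → IsPath G a b qs → walkSign G σ ps ≡ walkSign G σ qs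
    potential⇒pathSignsAgree a b (x ∷ ps) (y ∷ qs) (w , refl , end , _) (w′ , refl , end′ , _) =
      trans (walkSign-potential x ps b w end) (sym (walkSign-potential x qs b w′ end′))

    potential⇒switchingEquivalent : SwitchingEquivalent G σ (allPos G)
    potential⇒switchingEquivalent with parity-surjective-Node p
    ... | ss , ss-ok = ss , λ e v i → begin
      applySwitches G ss σ e v                                ≡⟨ applySwitches-parity ss σ e v ⟩
      parity nodeFlips ss (inj₁ v) * parity nodeFlips ss (inj₂ e) * σ e v
        ≡⟨ cong₂ (λ x y → x * y * σ e v) (ss-ok (inj₁ v)) (ss-ok (inj₂ e)) ⟩
      p (inj₁ v) * p (inj₂ e) * σ e v                         ≡⟨ cong (p (inj₁ v) * p (inj₂ e) *_) (p-pot (i , refl)) ⟩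
      p (inj₁ v) * p (inj₂ e) * (p (inj₁ v) * p (inj₂ e))     ≡⟨ s*s≡+ (p (inj₁ v) * p (inj₂ e)) ⟩
      ⊕                                                       ∎
      where open ≡-Reasoning

  switchingEquivalent⇒potential : SwitchingEquivalent G σ (allPos G) → Potential (edges IG)
  switchingEquivalent⇒potential (ss , switched) = incidences⇒potential (parity nodeFlips ss)
    λ {e} {v} i → s*t≡+⇒t≡s (trans (sym (applySwitches-parity ss σ e v)) (switched e v i))

  positiveCycles⇒balanced : (∀ cs → IsCycle G cs → walkSign G σ (closeUp cs) ≡ ⊕) → Balanced IG
  positiveCycles⇒balanced positive (_ ∷ [])     (s≤s () , _)
  positiveCycles⇒balanced positive (_ ∷ _ ∷ []) (s≤s (s≤s ()) , _)
  positiveCycles⇒balanced positive cs@(c ∷ d ∷ e ∷ r) (_ , uniq , ch) =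
    trans (sym (walkSign≡chainSign (closeUp cs)))
          (positive cs (chain⇒walk c _ ch , uniq , cycle-uniqueIncidences c d e r uniq))

  pathSignsAgree⇒balanced :
    (∀ a b ps qs → IsPath G a b ps → IsPath G a b qs → walkSign G σ ps ≡ walkSign G σ qs) → Balanced IG
  pathSignsAgree⇒balanced agree cs (len , uniq , ch) with initLast cs
  pathSignsAgree⇒balanced agree _ (() , _)                 | []
  pathSignsAgree⇒balanced agree _ (s≤s () , _)             | [] ∷ʳ′ _
  pathSignsAgree⇒balanced agree _ (_ , uniq@(c∉ ∷ _) , ch) | (c ∷ R) ∷ʳ′ l = begin
    chainSign IG (c ∷ (R ++ [ l ]) ++ [ c ])         ≡⟨ cong (chainSign IG) reassoc ⟩
    chainSign IG ((c ∷ R) ++ l ∷ [ c ])              ≡⟨ chainSign-++ IG (c ∷ R) l [ c ] ⟩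
    chainSign IG (c ∷ R ++ [ l ]) * (sgn IG l c * ⊕) ≡⟨ cong₂ _*_ long≡short (cong (_* ⊕) (incSign-sym l c)) ⟩
    incSign G σ c l * ⊕ * (incSign G σ c l * ⊕)      ≡⟨ s*s≡+ (incSign G σ c l * ⊕) ⟩
    ⊕                                                ∎
    where
    open ≡-Reasoning
    reassoc : c ∷ (R ++ [ l ]) ++ [ c ] ≡ (c ∷ R) ++ l ∷ [ c ]
    reassoc = cong (c ∷_) (++-assoc R [ l ] [ c ])
    pieces : AdjChain IG (c ∷ R ++ [ l ]) × AdjChain IG (l ∷ [ c ])
    pieces = chain-split IG (c ∷ R) l [ c ] (subst (AdjChain IG) reassoc ch)
    c≢l : c ≢ l
    c≢l = All.lookup c∉ (∈-++⁺ʳ R (here refl))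
    long : IsPath G c l (c ∷ R ++ [ l ])
    long = chain⇒walk c _ (proj₁ pieces) , refl , endsAt-∷ʳ c R l , uniq , unique⇒uniqueIncidences _ uniq
    short : IsPath G c l (c ∷ [ l ])
    short = (incPair-sym l c (adj⇒incPair l c (proj₁ (proj₂ pieces))) , tt) , refl , refl
          , (c≢l All.∷ All.[]) ∷ All.[] ∷ [] , All.[] ∷ []
    long≡short : chainSign IG (c ∷ R ++ [ l ]) ≡ incSign G σ c l * ⊕
    long≡short = trans (sym (walkSign≡chainSign (c ∷ R ++ [ l ]))) (agree c l _ _ long short)

  incidenceGraph-balanced⇒potential : Balanced IG → Potential (edges IG)
  incidenceGraph-balanced⇒potential = balanced⇒potential IG incidenceGraph-simple +↔⊎

theorem2p2 : (G : Hypergraph) → EdgesDistinct G → (σ : Orientation G) →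
    (IncidenceBalanced G σ
       ⇔ (∀ cs → IsCycle G cs → walkSign G σ (closeUp cs) ≡ ⊕))
    × (IncidenceBalanced G σ
       ⇔ (∀ a b p q → IsPath G a b p → IsPath G a b q →
            walkSign G σ p ≡ walkSign G σ q))
    × (IncidenceBalanced G σ ⇔ Balanced (incidenceGraph G σ))
    × (IncidenceBalanced G σ ⇔ SwitchingEquivalent G σ (allPos G))
theorem2p2 G _ σ =
    mk⇔ (potential⇒positiveCycles ∘ toPotential) (fromPotential ∘ positiveCycles⇒balanced)
  , mk⇔ (potential⇒pathSignsAgree ∘ toPotential) (fromPotential ∘ pathSignsAgree⇒balanced)
  , mk⇔ (potential⇒balanced IG ∘ toPotential) fromPotential
  , mk⇔ (potential⇒switchingEquivalent ∘ toPotential) (potential⇒incidenceBalanced ∘ switchingEquivalent⇒potential)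
  where
  open Oriented G σ
  toPotential : IncidenceBalanced G σ → Potential (edges IG)
  toPotential = incidenceBalanced⇒potential
  fromPotential : Balanced IG → IncidenceBalanced G σ
  fromPotential = potential⇒incidenceBalanced ∘ incidenceGraph-balanced⇒potential
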